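{- Let $p\geq 2$ and $n=2^p-1$. Then there exists a perfect code $C$ in the generalized Lucas cube $\Lambda_n(1^n)$ with $|C|=\frac{2^n}{n+1}$.
   Context: The hypercube $Q_n$ has as vertex set the binary strings of length $n$, two strings being adjacent if they differ in exactly one position. For a binary string $b_1\dots b_n$ and $1\le i\le n$, its $i$-th circulation is $b_i\dots b_nb_1\dots b_{i-1}$. For an integer $s\ge1$, the generalized Lucas cube $\Lambda_n(1^s)$ is the subgraph of $Q_n$ induced by the binary strings of length $n$ none of whose circulations contains $1^s$ (the string of $s$ ones) as a substring. A perfect code of a graph $G$ is a set $C$ of vertices such that every vertex of $G$ is at distance at most $1$ in $G$ from exactly one vertex of $C$. -}

module Defs where

open import Data.Nat using (ℕ; zero; suc; _+_; _*_; _^_; _≤_; _<_; _%_)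
open import Data.Nat.DivMod using (m%n<n)
open import Data.Bool using (Bool; true; false)
open import Data.Fin using (Fin; toℕ; fromℕ<)
open import Data.Vec using (Vec; []; _∷_; lookup)
open import Data.Product using (Σ; _×_; _,_)
open import Data.Sum using (_⊎_)
open import Data.List using (List; length)
open import Data.List.Membership.Propositional using (_∈_)
open import Data.List.Relation.Unary.All using (All)
open import Data.List.Relation.Unary.Unique.Propositional using (Unique)
open import Relation.Nullary using (¬_)
open import Relation.Binary.PropositionalEquality using (_≡_)

Word : ℕ → Set
Word n = Vec Bool n

bitAt : ∀ {n} → Word n → ℕ → Bool
bitAt {zero}  w k = false
bitAt {suc n} w k = lookup w (fromℕ< (m%n<n k (suc n)))

-- The i-th circulation (0-based i): b_i … b_{n-1} b_0 … b_{i-1}.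
circ : ∀ {n} → Fin n → Word n → Word n
circ {zero}  i w = []
circ {suc n} i w = Data.Vec.tabulate (λ k → bitAt w (toℕ i + toℕ k))
  where import Data.Vec

-- w contains 1^s as a (contiguous, non-wrapping) substring:
-- there is j with j + s ≤ n and w_{j}, …, w_{j+s-1} all equal to 1.
containsOnes : ∀ {n} → ℕ → Word n → Set
containsOnes {n} s w =
  Σ ℕ λ j → (j + s ≤ n) × (∀ k → k < s → bitAt w (j + k) ≡ true)

InΛ : (n s : ℕ) → Word n → Set
InΛ n s w = ∀ (i : Fin n) → ¬ containsOnes s (circ i w)

diffBit : Bool → Bool → ℕ
diffBit true  true  = 0
diffBit false false = 0
diffBit _     _     = 1

hamming : ∀ {n} → Word n → Word n → ℕ
hamming []       []       = 0
hamming (a ∷ u)  (b ∷ v)  = diffBit a b + hamming u v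

Adjacent : ∀ {n} → Word n → Word n → Set
Adjacent u v = hamming u v ≡ 1

-- Distance at most 1 in the induced subgraph Λ_n(1^s) between two of
-- its vertices (an edge of Q_n between vertices of an induced subgraph
-- is an edge of that subgraph).
Close : ∀ {n} → Word n → Word n → Set
Close u v = (u ≡ v) ⊎ Adjacent u v

record PerfectCode (n s : ℕ) (C : List (Word n)) : Set where
  field
    inΛ       : All (InΛ n s) C
    noDup     : Unique C
    covers    : ∀ v → InΛ n s v → Σ (Word n) λ c → (c ∈ C) × Close v c
    uniqueCov : ∀ v → InΛ n s v → ∀ c c' → c ∈ C → c' ∈ C →
                Close v c → Close v c' → c ≡ c'

module Submission where

-- Proof idea.  Λ_n(1^n) is the hypercube Q_n with the single vertex 1^n
-- removed, so a perfect code of Q_n that does not contain 1^n is a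
-- perfect code of Λ_n(1^n).  Such codes of length 2^p - 1 are built by a
-- doubling construction of Hamming type: from a perfect code C of Q_m one
-- obtains the perfect code
--     C' = { (¬parity u) u (u ⊕ v) : u ∈ Q_m, v ∈ C }
-- of Q_(2m+1), with |C'| = 2^m |C|; when m is odd no word of C' is 1^(2m+1).
-- Starting from {0} ⊆ Q_1 this gives codes of lengths 1, 3, 7, ….

open import Defs
open import Algebra.Bundles using (CommutativeSemigroup)
import Algebra.Properties.CommutativeSemigroup as CommutativeSemigroupProperties
open import Data.Bool using (Bool; true; false; not; _xor_)
open import Data.Bool.Properties
  using (xor-assoc; xor-comm; xor-same; xor-identityʳ; not-involutive)
open import Data.Empty using (⊥-elim)
open import Data.Fin using (Fin; toℕ; fromℕ<)
open import Data.Fin.Properties using (toℕ-fromℕ<; fromℕ<-cong; fromℕ<-toℕ; toℕ<n)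
open import Data.List using (List; length; map; cartesianProductWith)
  renaming (_∷_ to _∷ₗ_; [] to []ₗ)
open import Data.List.Membership.Propositional using (_∈_)
open import Data.List.Membership.Propositional.Properties
  using (∈-cartesianProductWith⁺; ∈-cartesianProductWith⁻)
open import Data.List.Properties using (length-++; length-map)
open import Data.List.Relation.Unary.All as All using (All; []; _∷_)
open import Data.List.Relation.Unary.AllPairs using ([]; _∷_)
open import Data.List.Relation.Unary.Any using (here; there)
open import Data.List.Relation.Unary.Unique.Propositional using (Unique)
open import Data.List.Relation.Unary.Unique.Propositional.Properties
  using (cartesianProductWith⁺)
open import Data.Nat using (ℕ; zero; suc; _+_; _*_; _^_; _∸_; _≥_; _≤_; _%_; z≤n; s≤s; NonZero)
open import Data.Nat.DivMod using (m%n<n; %-distribˡ-+; m%n%n≡m%n; [m+n]%n≡m%n; m<n⇒m%n≡m)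
open import Data.Nat.Properties
open import Data.Nat.Solver using (module +-*-Solver)
open import Data.Product using (Σ; _×_; _,_; proj₂)
open import Data.Sum using (_⊎_; inj₁; inj₂)
open import Data.Vec using (Vec; []; _∷_; _++_; replicate; lookup; zipWith; splitAt)
open import Data.Vec.Properties
  using ( zipWith-assoc; zipWith-comm; zipWith-identityˡ; zipWith-identityʳ
        ; zipWith-inverseˡ; map-id; ∷-injective; ++-injective
        ; ++-injectiveˡ; lookup∘tabulate)
open import Relation.Binary.PropositionalEquality
open import Relation.Binary.PropositionalEquality.Algebra using (isMagma)
open import Relation.Nullary using (¬_)

private variable
  n m : ℕ

infixl 6 _⊕_
_⊕_ : Vec Bool n → Vec Bool n → Vec Bool n
_⊕_ = zipWith _xor_

𝟎 : Vec Bool n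
𝟎 = replicate _ false

⊕-assoc : (x y z : Vec Bool n) → (x ⊕ y) ⊕ z ≡ x ⊕ (y ⊕ z)
⊕-assoc = zipWith-assoc xor-assoc

⊕-comm : (x y : Vec Bool n) → x ⊕ y ≡ y ⊕ x
⊕-comm = zipWith-comm xor-comm

⊕-identityˡ : (x : Vec Bool n) → 𝟎 ⊕ x ≡ x
⊕-identityˡ = zipWith-identityˡ (λ _ → refl)

⊕-identityʳ : (x : Vec Bool n) → x ⊕ 𝟎 ≡ x
⊕-identityʳ = zipWith-identityʳ xor-identityʳ

⊕-self : (x : Vec Bool n) → x ⊕ x ≡ 𝟎
⊕-self x = trans (cong (_⊕ x) (sym (map-id x))) (zipWith-inverseˡ xor-same x)

⊕-cancelˡ : (x y : Vec Bool n) → x ⊕ (x ⊕ y) ≡ y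
⊕-cancelˡ x y = begin
  x ⊕ (x ⊕ y)  ≡⟨ ⊕-assoc x x y ⟨
  (x ⊕ x) ⊕ y  ≡⟨ cong (_⊕ y) (⊕-self x) ⟩
  𝟎 ⊕ y        ≡⟨ ⊕-identityˡ y ⟩
  y            ∎
  where open ≡-Reasoning

-- (Vec Bool n, ⊕) as a library commutative semigroup, so that its
-- rearrangement laws (here the interchange law) can be reused.
⊕-commutativeSemigroup : ℕ → CommutativeSemigroup _ _
⊕-commutativeSemigroup n = record
  { Carrier                = Vec Bool n
  ; _≈_                    = _≡_
  ; _∙_                    = _⊕_
  ; isCommutativeSemigroup = record
    { isSemigroup = record { isMagma = isMagma _⊕_ ; assoc = ⊕-assoc }
    ; comm        = ⊕-comm
    }
  }

⊕-interchange : (a b c d : Vec Bool n) → (a ⊕ b) ⊕ (c ⊕ d) ≡ (a ⊕ c) ⊕ (b ⊕ d)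
⊕-interchange {n} = interchange
  where open CommutativeSemigroupProperties (⊕-commutativeSemigroup n)

weight : Vec Bool n → ℕ
weight []          = 0
weight (true  ∷ x) = suc (weight x)
weight (false ∷ x) = weight x

weight≡0⇒𝟎 : (x : Vec Bool n) → weight x ≡ 0 → x ≡ 𝟎
weight≡0⇒𝟎 []          _ = refl
weight≡0⇒𝟎 (false ∷ x) w = cong (false ∷_) (weight≡0⇒𝟎 x w)

weight-⊕ : (x y : Vec Bool n) → weight (x ⊕ y) ≤ weight x + weight y
weight-⊕ []          []          = z≤n
weight-⊕ (true  ∷ x) (true  ∷ y) =
  ≤-trans (weight-⊕ x y) (+-mono-≤ (n≤1+n _) (n≤1+n _))
weight-⊕ (true  ∷ x) (false ∷ y) = s≤s (weight-⊕ x y)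
weight-⊕ (false ∷ x) (true  ∷ y) =
  ≤-trans (s≤s (weight-⊕ x y)) (≤-reflexive (sym (+-suc _ _)))
weight-⊕ (false ∷ x) (false ∷ y) = weight-⊕ x y

parity : Vec Bool n → Bool
parity []      = false
parity (b ∷ x) = b xor parity x

parity-++ : (x : Vec Bool m) (y : Vec Bool n) →
            parity (x ++ y) ≡ parity x xor parity y
parity-++ []      y = refl
parity-++ (b ∷ x) y = trans (cong (b xor_) (parity-++ x y)) (sym (xor-assoc b _ _))

replicate-+ : {A : Set} (a : A) → replicate (m + n) a ≡ replicate m a ++ replicate n a
replicate-+ {zero}  a = refl
replicate-+ {suc m} a = cong (a ∷_) (replicate-+ {m} a)

parity-ones-odd : ∀ k → parity (replicate (suc (k + k)) true) ≡ true
parity-ones-odd k = begin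
  not (parity (replicate (k + k) true))
    ≡⟨ cong (λ x → not (parity x)) (replicate-+ {k} true) ⟩
  not (parity (replicate k true ++ replicate k true))
    ≡⟨ cong not (parity-++ (replicate k true) (replicate k true)) ⟩
  not (parity (replicate k true) xor parity (replicate k true))
    ≡⟨ cong not (xor-same (parity (replicate k true))) ⟩
  true ∎
  where open ≡-Reasoning

hamming≡weight : (x y : Vec Bool n) → hamming x y ≡ weight (x ⊕ y)
hamming≡weight []          []          = refl
hamming≡weight (true  ∷ x) (true  ∷ y) = hamming≡weight x y
hamming≡weight (true  ∷ x) (false ∷ y) = cong suc (hamming≡weight x y)
hamming≡weight (false ∷ x) (true  ∷ y) = cong suc (hamming≡weight x y)
hamming≡weight (false ∷ x) (false ∷ y) = hamming≡weight x y

hamming-self : (x : Vec Bool n) → hamming x x ≡ 0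
hamming-self {n} x = begin
  hamming x x     ≡⟨ hamming≡weight x x ⟩
  weight (x ⊕ x)  ≡⟨ cong weight (⊕-self x) ⟩
  weight (𝟎 {n})  ≡⟨ weight-𝟎 n ⟩
  0               ∎
  where
  open ≡-Reasoning
  weight-𝟎 : ∀ n → weight (𝟎 {n}) ≡ 0
  weight-𝟎 zero    = refl
  weight-𝟎 (suc n) = weight-𝟎 n

hamming≡0⇒≡ : (x y : Vec Bool n) → hamming x y ≡ 0 → x ≡ y
hamming≡0⇒≡ x y d≡0 = begin
  x                ≡⟨ ⊕-identityʳ x ⟨
  x ⊕ 𝟎            ≡⟨ cong (x ⊕_) (weight≡0⇒𝟎 (x ⊕ y) (trans (sym (hamming≡weight x y)) d≡0)) ⟨
  x ⊕ (x ⊕ y)      ≡⟨ ⊕-cancelˡ x y ⟩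
  y                ∎
  where open ≡-Reasoning

hamming-sym : (x y : Vec Bool n) → hamming x y ≡ hamming y x
hamming-sym x y = begin
  hamming x y     ≡⟨ hamming≡weight x y ⟩
  weight (x ⊕ y)  ≡⟨ cong weight (⊕-comm x y) ⟩
  weight (y ⊕ x)  ≡⟨ hamming≡weight y x ⟨
  hamming y x     ∎
  where open ≡-Reasoning

hamming-translate : (z x y : Vec Bool n) → hamming (z ⊕ x) (z ⊕ y) ≡ hamming x y
hamming-translate z x y = begin
  hamming (z ⊕ x) (z ⊕ y)     ≡⟨ hamming≡weight (z ⊕ x) (z ⊕ y) ⟩
  weight ((z ⊕ x) ⊕ (z ⊕ y))  ≡⟨ cong weight (⊕-interchange z x z y) ⟩
  weight ((z ⊕ z) ⊕ (x ⊕ y))  ≡⟨ cong (λ e → weight (e ⊕ (x ⊕ y))) (⊕-self z) ⟩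
  weight (𝟎 ⊕ (x ⊕ y))        ≡⟨ cong weight (⊕-identityˡ (x ⊕ y)) ⟩
  weight (x ⊕ y)              ≡⟨ hamming≡weight x y ⟨
  hamming x y                 ∎
  where open ≡-Reasoning

hamming-⊕ : (x y x' y' : Vec Bool n) →
            hamming (x ⊕ y) (x' ⊕ y') ≤ hamming x x' + hamming y y'
hamming-⊕ x y x' y' = begin
  hamming (x ⊕ y) (x' ⊕ y')        ≡⟨ hamming≡weight (x ⊕ y) (x' ⊕ y') ⟩
  weight ((x ⊕ y) ⊕ (x' ⊕ y'))     ≡⟨ cong weight (⊕-interchange x y x' y') ⟩
  weight ((x ⊕ x') ⊕ (y ⊕ y'))     ≤⟨ weight-⊕ (x ⊕ x') (y ⊕ y') ⟩
  weight (x ⊕ x') + weight (y ⊕ y') ≡⟨ cong₂ _+_ (hamming≡weight x x') (hamming≡weight y y') ⟨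
  hamming x x' + hamming y y'       ∎
  where open ≤-Reasoning

-- The triangle inequality, from x ⊕ z = (x ⊕ y) ⊕ (y ⊕ z).
hamming-triangle : (x y z : Vec Bool n) → hamming x z ≤ hamming x y + hamming y z
hamming-triangle x y z = begin
  hamming x z                       ≡⟨ hamming≡weight x z ⟩
  weight (x ⊕ z)                    ≡⟨ cong (λ e → weight (x ⊕ e)) (⊕-cancelˡ y z) ⟨
  weight (x ⊕ (y ⊕ (y ⊕ z)))        ≡⟨ cong weight (⊕-assoc x y (y ⊕ z)) ⟨
  weight ((x ⊕ y) ⊕ (y ⊕ z))        ≤⟨ weight-⊕ (x ⊕ y) (y ⊕ z) ⟩
  weight (x ⊕ y) + weight (y ⊕ z)   ≡⟨ cong₂ _+_ (hamming≡weight x y) (hamming≡weight y z) ⟨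
  hamming x y + hamming y z         ∎
  where open ≤-Reasoning

hamming-++ : (x x' : Vec Bool m) (y y' : Vec Bool n) →
             hamming (x ++ y) (x' ++ y') ≡ hamming x x' + hamming y y'
hamming-++ []      []       y y' = refl
hamming-++ (a ∷ x) (b ∷ x') y y' =
  trans (cong (diffBit a b +_) (hamming-++ x x' y y')) (sym (+-assoc (diffBit a b) _ _))

hamming-offset : (x e : Vec Bool n) → hamming x (x ⊕ e) ≡ weight e
hamming-offset x e = trans (hamming≡weight x (x ⊕ e)) (cong weight (⊕-cancelˡ x e))

parity-flip : (x y : Vec Bool n) → hamming x y ≡ 1 → parity x ≡ not (parity y)
parity-flip []          []          ()
parity-flip (true  ∷ x) (true  ∷ y) d≡1 = cong not (parity-flip x y d≡1)
parity-flip (false ∷ x) (false ∷ y) d≡1 = parity-flip x y d≡1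
parity-flip (true  ∷ x) (false ∷ y) d≡1 =
  cong (λ z → not (parity z)) (hamming≡0⇒≡ x y (suc-injective d≡1))
parity-flip (false ∷ x) (true  ∷ y) d≡1 =
  trans (cong parity (hamming≡0⇒≡ x y (suc-injective d≡1))) (sym (not-involutive _))

hamming≤1⇒Close : (v c : Word n) → hamming v c ≤ 1 → Close v c
hamming≤1⇒Close v c d≤1 with hamming v c in d
... | zero     = inj₁ (hamming≡0⇒≡ v c d)
... | suc zero = inj₂ refl
hamming≤1⇒Close v c (s≤s ()) | suc (suc _)

Close⇒hamming≤1 : (v c : Word n) → Close v c → hamming v c ≤ 1
Close⇒hamming≤1 v .v (inj₁ refl) = ≤-trans (≤-reflexive (hamming-self v)) z≤n
Close⇒hamming≤1 v c  (inj₂ d≡1)  = ≤-reflexive d≡1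

record CubePerfectCode (n : ℕ) (C : List (Word n)) : Set where
  field
    noDup     : Unique C
    covers    : ∀ v → Σ (Word n) λ c → c ∈ C × hamming v c ≤ 1
    separated : ∀ {c c'} → c ∈ C → c' ∈ C → hamming c c' ≤ 2 → c ≡ c'

bits : List Bool
bits = true ∷ₗ false ∷ₗ []ₗ

allWords : ∀ m → List (Word m)
allWords zero    = [] ∷ₗ []ₗ
allWords (suc m) = cartesianProductWith _∷_ bits (allWords m)

allWords-complete : (w : Word m) → w ∈ allWords m
allWords-complete []          = here refl
allWords-complete (true  ∷ w) =
  ∈-cartesianProductWith⁺ _∷_ {xs = bits} (here refl) (allWords-complete w)
allWords-complete (false ∷ w) =
  ∈-cartesianProductWith⁺ _∷_ {xs = bits} (there (here refl)) (allWords-complete w)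

allWords-unique : ∀ m → Unique (allWords m)
allWords-unique zero    = [] ∷ []
allWords-unique (suc m) =
  cartesianProductWith⁺ _∷_ ∷-injective (((λ ()) ∷ []) ∷ [] ∷ []) (allWords-unique m)

length-cartesianProductWith : {A B D : Set} (f : A → B → D) (xs : List A) (ys : List B) →
  length (cartesianProductWith f xs ys) ≡ length xs * length ys
length-cartesianProductWith f []ₗ        ys = refl
length-cartesianProductWith f (x ∷ₗ xs) ys = trans (length-++ (map (f x) ys))
  (cong₂ _+_ (length-map (f x) ys) (length-cartesianProductWith f xs ys))

allWords-length : ∀ m → length (allWords m) ≡ 2 ^ m
allWords-length zero    = refl
allWords-length (suc m) =
  trans (length-cartesianProductWith _∷_ bits (allWords m))
        (cong (2 *_) (allWords-length m))

diffBit≤1 : ∀ a b → diffBit a b ≤ 1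
diffBit≤1 true  true  = z≤n
diffBit≤1 true  false = ≤-refl
diffBit≤1 false true  = ≤-refl
diffBit≤1 false false = z≤n

diffBit-not : ∀ x → diffBit (not x) x ≡ 1
diffBit-not true  = refl
diffBit-not false = refl

diffBit-choice : ∀ b x → diffBit b x ≡ 0 ⊎ diffBit b (not x) ≡ 0
diffBit-choice true  true  = inj₁ refl
diffBit-choice true  false = inj₂ refl
diffBit-choice false true  = inj₂ refl
diffBit-choice false false = inj₁ refl

module Doubling {m : ℕ} (C : List (Word m)) (perfect : CubePerfectCode m C) where
  open CubePerfectCode perfect

  encode : Word m → Word m → Word (suc (m + m))
  encode u v = not (parity u) ∷ (u ++ (u ⊕ v))

  doubled : List (Word (suc (m + m)))
  doubled = cartesianProductWith encode (allWords m) C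

  -- Distinct pairs (u, v) give distinct encodings, since v = u ⊕ (u ⊕ v).
  encode-injective : ∀ {u u' v v'} → encode u v ≡ encode u' v' → u ≡ u' × v ≡ v'
  encode-injective {u} {u'} {v} {v'} eq
    with refl , halves ← ++-injective u u' (proj₂ (∷-injective eq)) =
    refl , (begin
      v            ≡⟨ ⊕-cancelˡ u v ⟨
      u ⊕ (u ⊕ v)  ≡⟨ cong (u ⊕_) halves ⟩
      u ⊕ (u ⊕ v') ≡⟨ ⊕-cancelˡ u v' ⟩
      v'           ∎)
    where open ≡-Reasoning

  distance-to-encode : ∀ b (a a₂ u v : Word m) →
    hamming (b ∷ (a ++ a₂)) (encode u v) ≡
    diffBit b (not (parity u)) + (hamming a u + hamming a₂ (u ⊕ v))
  distance-to-encode b a a₂ u v = cong (diffBit b (not (parity u)) +_) (hamming-++ a u a₂ (u ⊕ v))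

  -- For w = b a a₂ put s = a ⊕ a₂.  For c ∈ C near s there are two
  -- candidate encodings near w: (a, c), which reproduces a and misses a₂
  -- by d(s,c); and (corrected a a₂ c, c), which reproduces a₂ exactly and
  -- misses a by d(s,c).
  corrected : Word m → Word m → Word m → Word m
  corrected a a₂ c = a ⊕ ((a ⊕ a₂) ⊕ c)

  near-uncorrected : ∀ b (a a₂ c : Word m) →
    hamming (b ∷ (a ++ a₂)) (encode a c) ≡ diffBit b (not (parity a)) + hamming (a ⊕ a₂) c
  near-uncorrected b a a₂ c = begin
    hamming (b ∷ (a ++ a₂)) (encode a c)
      ≡⟨ distance-to-encode b a a₂ a c ⟩
    diffBit b (not (parity a)) + (hamming a a + hamming a₂ (a ⊕ c))
      ≡⟨ cong (λ h → diffBit b (not (parity a)) + (hamming a a + hamming h (a ⊕ c))) (⊕-cancelˡ a a₂) ⟨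
    diffBit b (not (parity a)) + (hamming a a + hamming (a ⊕ (a ⊕ a₂)) (a ⊕ c))
      ≡⟨ cong (diffBit b (not (parity a)) +_) (cong₂ _+_ (hamming-self a) (hamming-translate a (a ⊕ a₂) c)) ⟩
    diffBit b (not (parity a)) + hamming (a ⊕ a₂) c
      ∎
    where open ≡-Reasoning

  corrected-distance : (a a₂ c : Word m) → hamming a (corrected a a₂ c) ≡ hamming (a ⊕ a₂) c
  corrected-distance a a₂ c =
    trans (hamming-offset a ((a ⊕ a₂) ⊕ c)) (sym (hamming≡weight (a ⊕ a₂) c))

  corrected-encodes : (a a₂ c : Word m) → corrected a a₂ c ⊕ c ≡ a₂
  corrected-encodes a a₂ c = begin
    (a ⊕ ((a ⊕ a₂) ⊕ c)) ⊕ c  ≡⟨ ⊕-assoc a _ c ⟩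
    a ⊕ (((a ⊕ a₂) ⊕ c) ⊕ c)  ≡⟨ cong (a ⊕_) (⊕-assoc (a ⊕ a₂) c c) ⟩
    a ⊕ ((a ⊕ a₂) ⊕ (c ⊕ c))  ≡⟨ cong (λ z → a ⊕ ((a ⊕ a₂) ⊕ z)) (⊕-self c) ⟩
    a ⊕ ((a ⊕ a₂) ⊕ 𝟎)        ≡⟨ cong (a ⊕_) (⊕-identityʳ (a ⊕ a₂)) ⟩
    a ⊕ (a ⊕ a₂)              ≡⟨ ⊕-cancelˡ a a₂ ⟩
    a₂                        ∎
    where open ≡-Reasoning

  near-corrected : ∀ b (a a₂ c : Word m) →
    hamming (b ∷ (a ++ a₂)) (encode (corrected a a₂ c) c) ≡
    diffBit b (not (parity (corrected a a₂ c))) + hamming (a ⊕ a₂) c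
  near-corrected b a a₂ c = begin
    hamming (b ∷ (a ++ a₂)) (encode a' c)
      ≡⟨ distance-to-encode b a a₂ a' c ⟩
    diffBit b (not (parity a')) + (hamming a a' + hamming a₂ (a' ⊕ c))
      ≡⟨ cong (diffBit b (not (parity a')) +_) (cong₂ _+_ (corrected-distance a a₂ c) a₂-exact) ⟩
    diffBit b (not (parity a')) + (hamming (a ⊕ a₂) c + 0)
      ≡⟨ cong (diffBit b (not (parity a')) +_) (+-identityʳ _) ⟩
    diffBit b (not (parity a')) + hamming (a ⊕ a₂) c
      ∎
    where
    open ≡-Reasoning
    a' : Word m
    a' = corrected a a₂ c
    a₂-exact : hamming a₂ (a' ⊕ c) ≡ 0
    a₂-exact = trans (cong (hamming a₂) (corrected-encodes a a₂ c)) (hamming-self a₂)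

  in-doubled : ∀ u {v} → v ∈ C → encode u v ∈ doubled
  in-doubled u v∈C = ∈-cartesianProductWith⁺ encode (allWords-complete u) v∈C

  -- Covering: if d(s,c) = 0 the first candidate is within distance 1; if
  -- d(s,c) = 1 the parities of a and its correction differ, so one of the
  -- two candidates also matches the leading bit b.
  cover-by : ∀ b (a a₂ c : Word m) → c ∈ C → hamming (a ⊕ a₂) c ≤ 1 →
    Σ (Word (suc (m + m))) λ w → w ∈ doubled × hamming (b ∷ (a ++ a₂)) w ≤ 1
  cover-by b a a₂ c c∈C s≈c with hamming (a ⊕ a₂) c in d
  ... | zero = encode a c , in-doubled a c∈C ,
               ≤-trans (≤-reflexive (trans (near-uncorrected b a a₂ c) (cong (_ +_) d)))
                       (≤-trans (≤-reflexive (+-identityʳ _)) (diffBit≤1 b _))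
  ... | suc zero with diffBit-choice b (not (parity a))
  ...   | inj₁ agree = encode a c , in-doubled a c∈C ,
            ≤-reflexive (trans (near-uncorrected b a a₂ c) (cong₂ _+_ agree d))
  ...   | inj₂ agree = encode (corrected a a₂ c) c , in-doubled (corrected a a₂ c) c∈C ,
            ≤-reflexive (trans (near-corrected b a a₂ c) (cong₂ _+_ agree' d))
    where
    flipped : parity (corrected a a₂ c) ≡ not (parity a)
    flipped = parity-flip (corrected a a₂ c) a (trans (hamming-sym (corrected a a₂ c) a) (trans (corrected-distance a a₂ c) d))
    agree' : diffBit b (not (parity (corrected a a₂ c))) ≡ 0
    agree' = trans (cong (λ p → diffBit b (not p)) flipped) agree
  cover-by b a a₂ c c∈C (s≤s ()) | suc (suc _)

  doubled-covers : ∀ w → Σ (Word (suc (m + m))) λ c → c ∈ doubled × hamming w c ≤ 1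
  doubled-covers (b ∷ r) with a , a₂ , refl ← splitAt m r
                         with c , c∈C , s≈c ← covers (a ⊕ a₂) = cover-by b a a₂ c c∈C s≈c

  -- The encoded codewords are at least as far apart as the codewords:
  -- v = u ⊕ (u ⊕ v), and the blocks u, u ⊕ v appear in the encoding.
  codeword-distance : (u u' v v' : Word m) → hamming v v' ≤ hamming (encode u v) (encode u' v')
  codeword-distance u u' v v' = begin
    hamming v v'                                  ≡⟨ cong₂ hamming (⊕-cancelˡ u v) (⊕-cancelˡ u' v') ⟨
    hamming (u ⊕ (u ⊕ v)) (u' ⊕ (u' ⊕ v'))        ≤⟨ hamming-⊕ u (u ⊕ v) u' (u' ⊕ v') ⟩
    hamming u u' + hamming (u ⊕ v) (u' ⊕ v')      ≤⟨ m≤n+m _ (diffBit (not (parity u)) (not (parity u'))) ⟩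
    diffBit (not (parity u)) (not (parity u')) + (hamming u u' + hamming (u ⊕ v) (u' ⊕ v'))
                                                  ≡⟨ distance-to-encode _ u (u ⊕ v) u' v' ⟨
    hamming (encode u v) (encode u' v')           ∎
    where open ≤-Reasoning

  row-distance : (u u' v : Word m) → hamming (encode u v) (encode u' v) ≡
    diffBit (not (parity u)) (not (parity u')) + (hamming u u' + hamming u u')
  row-distance u u' v = begin
    hamming (encode u v) (encode u' v)
      ≡⟨ distance-to-encode _ u (u ⊕ v) u' v ⟩
    diffBit (not (parity u)) (not (parity u')) + (hamming u u' + hamming (u ⊕ v) (u' ⊕ v))
      ≡⟨ cong (λ h → diffBit (not (parity u)) (not (parity u')) + (hamming u u' + h)) second-half ⟩
    diffBit (not (parity u)) (not (parity u')) + (hamming u u' + hamming u u')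
      ∎
    where
    open ≡-Reasoning
    second-half : hamming (u ⊕ v) (u' ⊕ v) ≡ hamming u u'
    second-half = trans (cong₂ hamming (⊕-comm u v) (⊕-comm u' v)) (hamming-translate v u u')

  -- Hence distinct encodings of one codeword are at distance at least 3:
  -- 2·d(u,u') ≥ 4 unless d(u,u') = 1, and then the parity bits differ.
  row-separated : (u u' v : Word m) → hamming (encode u v) (encode u' v) ≤ 2 → u ≡ u'
  row-separated u u' v close rewrite row-distance u u' v with hamming u u' in d
  ... | zero        = hamming≡0⇒≡ u u' d
  ... | suc zero    = ⊥-elim (three≰two (subst (λ x → x + 2 ≤ 2) parity-bits-differ close))
    where
    three≰two : ¬ (1 + 2 ≤ 2)
    three≰two (s≤s (s≤s ()))
    parity-bits-differ : diffBit (not (parity u)) (not (parity u')) ≡ 1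
    parity-bits-differ =
      trans (cong (λ p → diffBit (not p) (not (parity u'))) (parity-flip u u' d))
            (diffBit-not (not (parity u')))
  ... | suc (suc k) =
    ⊥-elim (four≰two (≤-trans (m≤n+m _ (diffBit (not (parity u)) (not (parity u')))) close))
    where
    four≰two : ¬ (suc (suc k) + suc (suc k) ≤ 2)
    four≰two (s≤s (s≤s h)) with () ← m+n≤o⇒n≤o k h

  doubled-separated : ∀ {w w'} → w ∈ doubled → w' ∈ doubled → hamming w w' ≤ 2 → w ≡ w'
  doubled-separated w∈ w'∈ close
    with u  , v  , _ , v∈C  , refl ← ∈-cartesianProductWith⁻ encode (allWords m) C w∈
       | u' , v' , _ , v'∈C , refl ← ∈-cartesianProductWith⁻ encode (allWords m) C w'∈
    with refl ← separated v∈C v'∈C (≤-trans (codeword-distance u u' v v') close)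
    with refl ← row-separated u u' v close = refl

  doubled-perfect : CubePerfectCode (suc (m + m)) doubled
  doubled-perfect = record
    { noDup     = cartesianProductWith⁺ encode encode-injective (allWords-unique m) noDup
    ; covers    = doubled-covers
    ; separated = doubled-separated
    }

  doubled-length : length doubled ≡ 2 ^ m * length C
  doubled-length = trans (length-cartesianProductWith encode (allWords m) C)
                         (cong (_* length C) (allWords-length m))

  -- For odd m the word 1^(2m+1) is not an encoding: its first block 1^m
  -- has odd parity, so its leading bit would have to be 0.
  doubled-avoids-ones : parity (replicate m true) ≡ true →
                        ∀ {w} → w ∈ doubled → w ≢ replicate (suc (m + m)) true
  doubled-avoids-ones odd w∈ w≡ones
    with u , v , _ , _ , refl ← ∈-cartesianProductWith⁻ encode (allWords m) C w∈
    with leading , blocks ← ∷-injective w≡ones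
    with refl ← ++-injectiveˡ u (replicate m true) (trans blocks (replicate-+ {m} true))
    with () ← trans (sym (cong not odd)) leading

record OnesFreePerfectCode (n : ℕ) : Set where
  field
    code       : List (Word n)
    perfect    : CubePerfectCode n code
    avoidsOnes : ∀ {c} → c ∈ code → c ≢ replicate n true
    size       : length code * (n + 1) ≡ 2 ^ n

doubling-size : ∀ m L → L * (m + 1) ≡ 2 ^ m → 2 ^ m * L * (suc (m + m) + 1) ≡ 2 ^ suc (m + m)
doubling-size m L size = begin
  2 ^ m * L * (suc (m + m) + 1)  ≡⟨ solve 3 (λ x l k → x :* l :* ((con 1 :+ (k :+ k)) :+ con 1)
                                                     := con 2 :* (x :* (l :* (k :+ con 1)))) refl (2 ^ m) L m ⟩
  2 * (2 ^ m * (L * (m + 1)))    ≡⟨ cong (λ z → 2 * (2 ^ m * z)) size ⟩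
  2 * (2 ^ m * 2 ^ m)            ≡⟨ cong (2 *_) (^-distribˡ-+-* 2 m m) ⟨
  2 ^ suc (m + m)                ∎
  where
  open ≡-Reasoning
  open +-*-Solver

double : parity (replicate m true) ≡ true → OnesFreePerfectCode m → OnesFreePerfectCode (suc (m + m))
double {m} odd P = record
  { code       = doubled
  ; perfect    = doubled-perfect
  ; avoidsOnes = doubled-avoids-ones odd
  ; size       = trans (cong (_* (suc (m + m) + 1)) doubled-length) (doubling-size m _ size)
  }
  where
  open OnesFreePerfectCode P
  open Doubling code perfect

trivialCode : OnesFreePerfectCode 1
trivialCode = record
  { code       = (false ∷ []) ∷ₗ []ₗ
  ; perfect    = record
    { noDup     = [] ∷ []
    ; covers    = λ { (b ∷ []) → (false ∷ []) , here refl , ≤-trans (≤-reflexive (+-identityʳ _)) (diffBit≤1 b false) }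
    ; separated = λ { (here refl) (here refl) _ → refl }
    }
  ; avoidsOnes = λ { (here refl) () }
  ; size       = refl
  }

codeLength : ℕ → ℕ
codeLength zero    = 1
codeLength (suc p) = suc (codeLength p + codeLength p)

codeLength-odd : ∀ p → parity (replicate (codeLength p) true) ≡ true
codeLength-odd zero    = refl
codeLength-odd (suc p) = parity-ones-odd (codeLength p)

codeLength≡ : ∀ p → codeLength p ≡ 2 ^ suc p ∸ 1
codeLength≡ p = trans (sym (m+n∸n≡m (codeLength p) 1)) (cong (_∸ 1) (codeLength+1 p))
  where
  open +-*-Solver
  codeLength+1 : ∀ p → codeLength p + 1 ≡ 2 ^ suc p
  codeLength+1 zero    = refl
  codeLength+1 (suc p) = trans
    (solve 1 (λ ℓ → (con 1 :+ (ℓ :+ ℓ)) :+ con 1 := con 2 :* (ℓ :+ con 1)) refl (codeLength p))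
    (cong (2 *_) (codeLength+1 p))

onesFreeCode : ∀ p → OnesFreePerfectCode (codeLength p)
onesFreeCode zero    = trivialCode
onesFreeCode (suc p) = double (codeLength-odd p) (onesFreeCode p)

-- A perfect code of Q_n all of whose words lie in Λ_n(1^s) is a perfect
-- code of Λ_n(1^s): Λ_n(1^s) is an induced subgraph, so covering is
-- inherited, and two codewords covering one vertex are at distance ≤ 2.
restrictPerfect : ∀ {n s} {C : List (Word n)} →
                  CubePerfectCode n C → All (InΛ n s) C → PerfectCode n s C
restrictPerfect {C = C} P C⊆Λ = record
  { inΛ       = C⊆Λ
  ; noDup     = noDup
  ; covers    = λ v _ → let (c , c∈C , v≈c) = covers v in c , c∈C , hamming≤1⇒Close v c v≈c
  ; uniqueCov = λ v _ c c' c∈C c'∈C v≈c v≈c' → separated c∈C c'∈C (begin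
      hamming c c'               ≤⟨ hamming-triangle c v c' ⟩
      hamming c v + hamming v c' ≡⟨ cong (_+ hamming v c') (hamming-sym c v) ⟩
      hamming v c + hamming v c' ≤⟨ +-mono-≤ (Close⇒hamming≤1 v c v≈c) (Close⇒hamming≤1 v c' v≈c') ⟩
      2                          ∎)
  }
  where
  open CubePerfectCode P
  open ≤-Reasoning

[m+n%d]%d≡[m+n]%d : ∀ a b d .{{_ : NonZero d}} → (a + b % d) % d ≡ (a + b) % d
[m+n%d]%d≡[m+n]%d a b d = begin
  (a + b % d) % d          ≡⟨ %-distribˡ-+ a (b % d) d ⟩
  (a % d + b % d % d) % d  ≡⟨ cong (λ r → (a % d + r) % d) (m%n%n≡m%n b d) ⟩
  (a % d + b % d) % d      ≡⟨ %-distribˡ-+ a b d ⟨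
  (a + b) % d              ∎
  where open ≡-Reasoning

bitAt-mod : (w : Word (suc n)) (k k' : ℕ) → k % suc n ≡ k' % suc n → bitAt w k ≡ bitAt w k'
bitAt-mod {n} w k k' k≡k' =
  cong (lookup w) (fromℕ<-cong _ _ k≡k' (m%n<n k (suc n)) (m%n<n k' (suc n)))

bitAt-lookup : (w : Word (suc n)) (t : Fin (suc n)) → bitAt w (toℕ t) ≡ lookup w t
bitAt-lookup w t = cong (lookup w)
  (trans (fromℕ<-cong _ _ (m<n⇒m%n≡m (toℕ<n t)) _ (toℕ<n t)) (fromℕ<-toℕ t (toℕ<n t)))

bitAt-circ : (i : Fin (suc n)) (w : Word (suc n)) (k : ℕ) →
             bitAt (circ i w) k ≡ bitAt w (toℕ i + k)
bitAt-circ {n} i w k =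
  trans (lookup∘tabulate (λ j → bitAt w (toℕ i + toℕ j)) (fromℕ< (m%n<n k (suc n))))
  (bitAt-mod w (toℕ i + toℕ (fromℕ< (m%n<n k (suc n)))) (toℕ i + k)
  (trans (cong (λ j → (toℕ i + j) % suc n) (toℕ-fromℕ< (m%n<n k (suc n))))
         ([m+n%d]%d≡[m+n]%d (toℕ i) k (suc n))))

all-true : (w : Word n) → (∀ t → lookup w t ≡ true) → w ≡ replicate n true
all-true []      _    = refl
all-true (b ∷ w) ones = cong₂ _∷_ (ones Fin.zero) (all-true w (λ t → ones (Fin.suc t)))
  where import Data.Fin as Fin

-- The only word of length n ≥ 1 outside Λ_n(1^n) is 1^n: an occurrence of
-- 1^n in a circulation of w fills that circulation, so every bit of w,
-- being some bit of the circulation, is 1.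
notOnes⇒InΛ : (w : Word (suc n)) → w ≢ replicate (suc n) true → InΛ (suc n) (suc n) w
notOnes⇒InΛ {n} w w≢ones i (j , fits , ones)
  with refl ← n≤0⇒n≡0 (+-cancelʳ-≤ (suc n) j 0 fits) = w≢ones (all-true w bit-is-one)
  where
  bit-is-one : ∀ t → lookup w t ≡ true
  bit-is-one t = begin
    lookup w t                   ≡⟨ bitAt-lookup w t ⟨
    bitAt w (toℕ t)              ≡⟨ bitAt-mod w (toℕ t) (toℕ i + k % suc n) position ⟩
    bitAt w (toℕ i + k % suc n)  ≡⟨ bitAt-circ i w (k % suc n) ⟨
    bitAt (circ i w) (k % suc n) ≡⟨ ones (k % suc n) (m%n<n k (suc n)) ⟩
    true                         ∎
    where
    open ≡-Reasoning
    k : ℕ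
    k = suc n ∸ toℕ i + toℕ t
    position : toℕ t % suc n ≡ (toℕ i + k % suc n) % suc n
    position = sym (begin
      (toℕ i + k % suc n) % suc n   ≡⟨ [m+n%d]%d≡[m+n]%d (toℕ i) k (suc n) ⟩
      (toℕ i + k) % suc n           ≡⟨ cong (_% suc n) (+-assoc (toℕ i) (suc n ∸ toℕ i) (toℕ t)) ⟨
      (toℕ i + (suc n ∸ toℕ i) + toℕ t) % suc n
                                    ≡⟨ cong (λ x → (x + toℕ t) % suc n) (m+[n∸m]≡n (<⇒≤ (toℕ<n i))) ⟩
      (suc n + toℕ t) % suc n       ≡⟨ cong (_% suc n) (+-comm (suc n) (toℕ t)) ⟩
      (toℕ t + suc n) % suc n       ≡⟨ [m+n]%n≡m%n (toℕ t) (suc n) ⟩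
      toℕ t % suc n                 ∎)

LucasPerfectCode : ℕ → Set
LucasPerfectCode n =
  Σ (List (Word n)) λ C → PerfectCode n n C × (length C * (n + 1) ≡ 2 ^ n)

lucasCode : OnesFreePerfectCode (suc n) → LucasPerfectCode (suc n)
lucasCode P = code , restrictPerfect perfect (All.tabulate λ c∈C → notOnes⇒InΛ _ (avoidsOnes c∈C)) , size
  where open OnesFreePerfectCode P

mainTheorem4 : ∀ (p : ℕ) → p ≥ 2 →
    Σ (List (Word (2 ^ p ∸ 1))) λ C →
      PerfectCode (2 ^ p ∸ 1) (2 ^ p ∸ 1) C ×
      (length C * ((2 ^ p ∸ 1) + 1) ≡ 2 ^ (2 ^ p ∸ 1))
mainTheorem4 (suc zero)    (s≤s ())
mainTheorem4 (suc (suc p)) _ =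
  subst LucasPerfectCode (codeLength≡ (suc p)) (lucasCode (onesFreeCode (suc p)))
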